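{- Let $\mathbf{t}_3$ be the ternary Thue--Morse word, the fixed point starting with $0$ of the morphism $0\mapsto012$, $1\mapsto120$, $2\mapsto201$. Then its additive complexity is the sequence $135^\omega$, i.e., $\rho^{\mathrm{add}}_{\mathbf{t}_3}(0)=1$, $\rho^{\mathrm{add}}_{\mathbf{t}_3}(1)=3$, and $\rho^{\mathrm{add}}_{\mathbf{t}_3}(n)=5$ for all $n\ge2$.
   Context: Letters $0,1,2$ are regarded as integers. Words $u,v$ are additively equivalent if $|u|=|v|$ and $|u|_1+2|u|_2=|v|_1+2|v|_2$ ($|w|_a$ counts occurrences of $a$); $\rho^{\mathrm{add}}_{\mathbf{x}}(n)$ is the number of additive equivalence classes of length-$n$ factors of $\mathbf{x}$. -}

module Defs where

open import Data.Nat using (ℕ; zero; suc; _+_)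
open import Data.Fin using (Fin; zero; suc; toℕ)
open import Data.List using (List; []; _∷_; concatMap; length; map; upTo)
open import Data.Nat.ListAction using (sum)
open import Data.List.Membership.Propositional using (_∈_)
open import Data.List.Relation.Unary.Unique.Propositional using (Unique)
open import Data.Product using (Σ; ∃; _×_; _,_)
open import Relation.Binary.PropositionalEquality using (_≡_)
open import Function.Bundles using (_⇔_)

Letter : Set
Letter = Fin 3

σ : Letter → List Letter
σ zero             = zero ∷ suc zero ∷ suc (suc zero) ∷ []
σ (suc zero)       = suc zero ∷ suc (suc zero) ∷ zero ∷ []
σ (suc (suc zero)) = suc (suc zero) ∷ zero ∷ suc zero ∷ []

σ* : List Letter → List Letter
σ* = concatMap σ

iter : ℕ → List Letter
iter zero    = zero ∷ []
iter (suc k) = σ* (iter k)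

-- Each σ^(k+1)(0) has σ^k(0) as prefix, and |σ^k(0)| = 3^k > k, so the
-- n-th letter of the fixed point t₃ = lim σ^k(0) is the n-th letter of σ^(n+1)(0).
lookupOr : List Letter → ℕ → Letter
lookupOr []       _       = zero
lookupOr (x ∷ xs) zero    = x
lookupOr (x ∷ xs) (suc n) = lookupOr xs n

t3 : ℕ → Letter
t3 n = lookupOr (iter (suc n)) n

factor : ℕ → ℕ → List Letter
factor n i = map (λ j → t3 (i + j)) (upTo n)

weight : List Letter → ℕ
weight w = sum (map toℕ w)

-- Two factors of the same length n are additively equivalent iff their weights
-- agree, so additive classes of length-n factors are in bijection with the set
-- of weights of length-n factors.
-- ρ^add_x(n) = k  :⇔  there is a duplicate-free list of exactly k naturals
-- which enumerates exactly the weights of length-n factors.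
AddComplexityIs : ℕ → ℕ → Set
AddComplexityIs n k =
  Σ (List ℕ) λ ws → Unique ws × length ws ≡ k ×
    (∀ s → (s ∈ ws) ⇔ (∃ λ i → weight (factor n i) ≡ s))

-- Write t for t₃. Since t (3m + r) is the r-th letter of σ (t m) and every σ a has weight 3,
-- a factor of length n starting at 3m + r, padded on the left to the block boundary 3m, ends
-- r + n = 3q + s letters later inside block m + q, and comparing the two partial blocks gives
--   weight + e (t m) r = n + e (t (m + q)) s,
-- where the excess e a r ∈ {0, 1, 2} is the weight of the length-r prefix of σ a, plus 1, minus r.
-- Hence every weight lies in [n − 2, n + 2]. For r, s ∈ {1, 2} each excess value is taken by some
-- letter, and every pair of letters occurs at every positive distance in t (induction on the
-- distance written in base 3, from distances 1 and 2), so for n ≥ 2 all five values occur.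

module Submission where

open import Defs
open import Data.Nat using (ℕ; zero; suc; _+_; _*_; _∸_; _≤_; _<_; z≤n; s≤s; z<s; >-nonZero)
open import Data.Nat.Properties
open import Data.Nat.DivMod using (_divMod_; result)
open import Data.Nat.Induction using (<-rec)
open import Data.Nat.ListAction using (sum)
open import Data.Nat.ListAction.Properties using (sum-++)
open import Data.Nat.Tactic.RingSolver using (solve-∀)
open import Data.Fin using (Fin; zero; suc; toℕ)
open import Data.Fin.Properties using (toℕ<n)
open import Data.List using ([]; _∷_; _++_; _∷ʳ_; [_]; length; map; take; applyUpTo; upTo)
open import Data.List.Properties using (length-++; ++-assoc; ++-identityʳ; map-++; concatMap-++; upTo-∷ʳ; length-applyUpTo)
open import Data.List.Membership.Propositional using (_∈_)
open import Data.List.Membership.Propositional.Properties using (∈-applyUpTo⁺; ∈-applyUpTo⁻)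
open import Data.List.Relation.Unary.Unique.Propositional.Properties using (applyUpTo⁺₁)
open import Data.Product using (∃; ∃₂; _×_; _,_)
open import Data.Sum using (inj₁; inj₂)
open import Function using (_∘_)
open import Function.Bundles using (mk⇔)
open import Relation.Binary.PropositionalEquality using (_≡_; refl; sym; trans; cong; cong₂; subst; module ≡-Reasoning)
open ≡-Reasoning
open import Algebra.Properties.CommutativeSemigroup +-commutativeSemigroup using (x∙yz≈y∙xz; x∙yz≈yx∙z)

complexity-of-interval : ∀ n a c →
  (∀ i → ∃ λ e → e < c × weight (factor n i) ≡ a + e) →
  (∀ e → e < c → ∃ λ i → weight (factor n i) ≡ a + e) →
  AddComplexityIs n c
complexity-of-interval n a c within attained =
  applyUpTo (a +_) c ,
  applyUpTo⁺₁ (a +_) c (λ i<j _ → <⇒≢ (+-monoʳ-< a i<j)) ,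
  length-applyUpTo (a +_) c ,
  λ s → mk⇔ (from-list s) (to-list s)
  where
  from-list : ∀ s → s ∈ applyUpTo (a +_) c → ∃ λ i → weight (factor n i) ≡ s
  from-list s s∈ with e , e<c , refl ← ∈-applyUpTo⁻ (a +_) s∈ = attained e e<c
  to-list : ∀ s → (∃ λ i → weight (factor n i) ≡ s) → s ∈ applyUpTo (a +_) c
  to-list s (i , refl) with e , e<c , w≡ ← within i =
    subst (_∈ applyUpTo (a +_) c) (sym w≡) (∈-applyUpTo⁺ (a +_) e<c)

lookupOr-++ˡ : ∀ xs ys {n} → n < length xs → lookupOr (xs ++ ys) n ≡ lookupOr xs n
lookupOr-++ˡ (x ∷ xs) ys {zero}  _        = refl
lookupOr-++ˡ (x ∷ xs) ys {suc n} (s≤s n<) = lookupOr-++ˡ xs ys n<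

lookupOr-++ʳ : ∀ xs ys n → lookupOr (xs ++ ys) (length xs + n) ≡ lookupOr ys n
lookupOr-++ʳ []       ys n = refl
lookupOr-++ʳ (x ∷ xs) ys n = lookupOr-++ʳ xs ys n

length-σ : ∀ a → length (σ a) ≡ 3
length-σ zero             = refl
length-σ (suc zero)       = refl
length-σ (suc (suc zero)) = refl

σ-head : ∀ a → lookupOr (σ a) 0 ≡ a
σ-head zero             = refl
σ-head (suc zero)       = refl
σ-head (suc (suc zero)) = refl

σ-tabulate : ∀ a → lookupOr (σ a) 0 ∷ lookupOr (σ a) 1 ∷ lookupOr (σ a) 2 ∷ [] ≡ σ a
σ-tabulate zero             = refl
σ-tabulate (suc zero)       = refl
σ-tabulate (suc (suc zero)) = refl

weight-σ : ∀ a → weight (σ a) ≡ 3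
weight-σ zero             = refl
weight-σ (suc zero)       = refl
weight-σ (suc (suc zero)) = refl

σ-column-surjective : ∀ (c : Fin 3) b → ∃ λ a → lookupOr (σ a) (toℕ c) ≡ b
σ-column-surjective zero             b                = b , σ-head b
σ-column-surjective (suc zero)       zero             = suc (suc zero) , refl
σ-column-surjective (suc zero)       (suc zero)       = zero , refl
σ-column-surjective (suc zero)       (suc (suc zero)) = suc zero , refl
σ-column-surjective (suc (suc zero)) zero             = suc zero , refl
σ-column-surjective (suc (suc zero)) (suc zero)       = suc (suc zero) , refl
σ-column-surjective (suc (suc zero)) (suc (suc zero)) = zero , refl

length-σ* : ∀ w → length (σ* w) ≡ length w * 3
length-σ* []      = refl
length-σ* (a ∷ w) = trans (length-++ (σ a)) (cong₂ _+_ (length-σ a) (length-σ* w))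

lookupOr-σ* : ∀ w m (r : Fin 3) → m < length w →
              lookupOr (σ* w) (m * 3 + toℕ r) ≡ lookupOr (σ (lookupOr w m)) (toℕ r)
lookupOr-σ* (a ∷ w) zero    r _ =
  lookupOr-++ˡ (σ a) (σ* w) (subst (toℕ r <_) (sym (length-σ a)) (toℕ<n r))
lookupOr-σ* (a ∷ w) (suc m) r (s≤s m<) = begin
  lookupOr (σ a ++ σ* w) (3 + (m * 3 + toℕ r))
    ≡⟨ cong (λ ℓ → lookupOr (σ a ++ σ* w) (ℓ + (m * 3 + toℕ r))) (sym (length-σ a)) ⟩
  lookupOr (σ a ++ σ* w) (length (σ a) + (m * 3 + toℕ r))
    ≡⟨ lookupOr-++ʳ (σ a) (σ* w) _ ⟩
  lookupOr (σ* w) (m * 3 + toℕ r)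
    ≡⟨ lookupOr-σ* w m r m< ⟩
  lookupOr (σ (lookupOr w m)) (toℕ r) ∎

iter-extends : ∀ k → ∃ λ u → iter (suc k) ≡ iter k ++ u
iter-extends zero    = _ , refl
iter-extends (suc k) with u , eq ← iter-extends k =
  σ* u , trans (cong σ* eq) (concatMap-++ σ (iter k) u)

iter-prefix : ∀ d k → ∃ λ u → iter (d + k) ≡ iter k ++ u
iter-prefix zero    k = [] , sym (++-identityʳ (iter k))
iter-prefix (suc d) k with u , eq ← iter-prefix d k | v , eq′ ← iter-extends (d + k) =
  u ++ v , trans eq′ (trans (cong (_++ v) eq) (++-assoc (iter k) u v))

lookupOr-iter-≤ : ∀ {k K n} → k ≤ K → n < length (iter k) →
                  lookupOr (iter K) n ≡ lookupOr (iter k) n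
lookupOr-iter-≤ {k} {K} {n} k≤K n< with u , eq ← iter-prefix (K ∸ k) k = begin
  lookupOr (iter K) n                ≡⟨ cong (λ j → lookupOr (iter j) n) (sym (m∸n+n≡m k≤K)) ⟩
  lookupOr (iter (K ∸ k + k)) n      ≡⟨ cong (λ w → lookupOr w n) eq ⟩
  lookupOr (iter k ++ u) n           ≡⟨ lookupOr-++ˡ (iter k) u n< ⟩
  lookupOr (iter k) n                ∎

n<length-iter : ∀ n → n < length (iter n)
n<length-iter zero    = z<s
n<length-iter (suc n) = subst (suc n <_) (sym (length-σ* (iter n)))
  (≤-<-trans n<L (m<m*n L 3 {{>-nonZero (≤-<-trans z≤n n<L)}} (s≤s (s≤s z≤n))))
  where
  L = length (iter n)
  n<L = n<length-iter n

t3-lookupOr-iter : ∀ k n → n < length (iter k) → t3 n ≡ lookupOr (iter k) n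
t3-lookupOr-iter k n n< with ≤-total k (suc n)
... | inj₁ k≤ = lookupOr-iter-≤ k≤ n<
... | inj₂ ≤k = sym (lookupOr-iter-≤ ≤k (<-trans (n<1+n n) (n<length-iter (suc n))))

t3-σ : ∀ m (r : Fin 3) → t3 (m * 3 + toℕ r) ≡ lookupOr (σ (t3 m)) (toℕ r)
t3-σ m r = begin
  t3 (m * 3 + toℕ r)                          ≡⟨ t3-lookupOr-iter (suc (suc m)) _ index< ⟩
  lookupOr (σ* (iter (suc m))) (m * 3 + toℕ r) ≡⟨ lookupOr-σ* (iter (suc m)) m r m<L ⟩
  lookupOr (σ (t3 m)) (toℕ r)                 ∎
  where
  m<L : m < length (iter (suc m))
  m<L = <-trans (n<1+n m) (n<length-iter (suc m))
  index< : m * 3 + toℕ r < length (σ* (iter (suc m)))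
  index< = subst (m * 3 + toℕ r <_) (sym (length-σ* (iter (suc m))))
    (≤-trans (+-monoʳ-< (m * 3) (toℕ<n r))
             (≤-trans (≤-reflexive (+-comm (m * 3) 3)) (*-monoˡ-≤ 3 m<L)))

t3-triple : ∀ m → t3 (m * 3) ≡ t3 m
t3-triple m = begin
  t3 (m * 3)               ≡⟨ cong t3 (+-identityʳ (m * 3)) ⟨
  t3 (m * 3 + 0)           ≡⟨ t3-σ m zero ⟩
  lookupOr (σ (t3 m)) 0    ≡⟨ σ-head (t3 m) ⟩
  t3 m                     ∎

factor-block : ∀ m → factor 3 (m * 3) ≡ σ (t3 m)
factor-block m = trans
  (cong₂ _∷_ (t3-σ m zero) (cong₂ _∷_ (t3-σ m (suc zero)) (cong [_] (t3-σ m (suc (suc zero))))))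
  (σ-tabulate (t3 m))

factor-∷ʳ : ∀ n i → factor (suc n) i ≡ factor n i ∷ʳ t3 (i + n)
factor-∷ʳ n i = trans (cong (map (λ j → t3 (i + j))) (sym (upTo-∷ʳ n))) (map-++ _ (upTo n) [ n ])

factor-++ : ∀ a b i → factor (a + b) i ≡ factor a i ++ factor b (i + a)
factor-++ a zero    i = trans (cong (λ n → factor n i) (+-identityʳ a)) (sym (++-identityʳ _))
factor-++ a (suc b) i = begin
  factor (a + suc b) i                               ≡⟨ cong (λ n → factor n i) (+-suc a b) ⟩
  factor (suc (a + b)) i                             ≡⟨ factor-∷ʳ (a + b) i ⟩
  factor (a + b) i ∷ʳ t3 (i + (a + b))               ≡⟨ cong₂ _∷ʳ_ (factor-++ a b i) (cong t3 (sym (+-assoc i a b))) ⟩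
  (factor a i ++ factor b (i + a)) ∷ʳ t3 (i + a + b) ≡⟨ ++-assoc (factor a i) _ _ ⟩
  factor a i ++ (factor b (i + a) ∷ʳ t3 (i + a + b)) ≡⟨ cong (factor a i ++_) (sym (factor-∷ʳ b (i + a))) ⟩
  factor a i ++ factor (suc b) (i + a)               ∎

weight-++ : ∀ xs ys → weight (xs ++ ys) ≡ weight xs + weight ys
weight-++ xs ys = trans (cong sum (map-++ toℕ xs ys)) (sum-++ (map toℕ xs) (map toℕ ys))

weight-factor-+ : ∀ a b i → weight (factor (a + b) i) ≡ weight (factor a i) + weight (factor b (i + a))
weight-factor-+ a b i = trans (cong weight (factor-++ a b i)) (weight-++ (factor a i) _)

weight-aligned : ∀ q m → weight (factor (q * 3) (m * 3)) ≡ q * 3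
weight-aligned zero    m = refl
weight-aligned (suc q) m = begin
  weight (factor (3 + q * 3) (m * 3))
    ≡⟨ weight-factor-+ 3 (q * 3) (m * 3) ⟩
  weight (factor 3 (m * 3)) + weight (factor (q * 3) (m * 3 + 3))
    ≡⟨ cong₂ _+_ (trans (cong weight (factor-block m)) (weight-σ (t3 m)))
                 (cong (weight ∘ factor (q * 3)) (+-comm (m * 3) 3)) ⟩
  3 + weight (factor (q * 3) (suc m * 3))
    ≡⟨ cong (3 +_) (weight-aligned q (suc m)) ⟩
  3 + q * 3 ∎

letter-weight : ∀ i → weight (factor 1 i) ≡ toℕ (t3 i)
letter-weight i = trans (+-identityʳ _) (cong (toℕ ∘ t3) (+-identityʳ i))

excess : Letter → Fin 3 → Fin 3
excess a                zero             = suc zero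
excess a                (suc zero)       = a
excess zero             (suc (suc zero)) = zero
excess (suc zero)       (suc (suc zero)) = suc (suc zero)
excess (suc (suc zero)) (suc (suc zero)) = suc zero

weight-take-σ : ∀ a r → weight (take (toℕ r) (σ a)) + 1 ≡ toℕ r + toℕ (excess a r)
weight-take-σ a                zero             = refl
weight-take-σ zero             (suc zero)       = refl
weight-take-σ (suc zero)       (suc zero)       = refl
weight-take-σ (suc (suc zero)) (suc zero)       = refl
weight-take-σ zero             (suc (suc zero)) = refl
weight-take-σ (suc zero)       (suc (suc zero)) = refl
weight-take-σ (suc (suc zero)) (suc (suc zero)) = refl

excess-surjective : ∀ (r : Fin 2) d → ∃ λ a → excess a (suc r) ≡ d
excess-surjective zero       d                = d , refl
excess-surjective (suc zero) zero             = zero , refl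
excess-surjective (suc zero) (suc zero)       = suc (suc zero) , refl
excess-surjective (suc zero) (suc (suc zero)) = suc zero , refl

factor-take-3 : ∀ (r : Fin 3) i → factor (toℕ r) i ≡ take (toℕ r) (factor 3 i)
factor-take-3 zero             i = refl
factor-take-3 (suc zero)       i = refl
factor-take-3 (suc (suc zero)) i = refl

weight-block-prefix : ∀ m r → weight (factor (toℕ r) (m * 3)) + 1 ≡ toℕ r + toℕ (excess (t3 m) r)
weight-block-prefix m r = begin
  weight (factor (toℕ r) (m * 3)) + 1
    ≡⟨ cong (λ w → weight w + 1) (trans (factor-take-3 r (m * 3)) (cong (take (toℕ r)) (factor-block m))) ⟩
  weight (take (toℕ r) (σ (t3 m))) + 1
    ≡⟨ weight-take-σ (t3 m) r ⟩
  toℕ r + toℕ (excess (t3 m) r) ∎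

weight-between-blocks : ∀ n m q (r s : Fin 3) → toℕ r + n ≡ toℕ s + q * 3 →
  weight (factor (toℕ r) (m * 3)) + weight (factor n (m * 3 + toℕ r))
    ≡ q * 3 + weight (factor (toℕ s) ((m + q) * 3))
weight-between-blocks n m q r s eq = begin
  weight (factor (toℕ r) (m * 3)) + weight (factor n (m * 3 + toℕ r))
    ≡⟨ weight-factor-+ (toℕ r) n (m * 3) ⟨
  weight (factor (toℕ r + n) (m * 3))
    ≡⟨ cong (λ ℓ → weight (factor ℓ (m * 3))) (trans eq (+-comm (toℕ s) (q * 3))) ⟩
  weight (factor (q * 3 + toℕ s) (m * 3))
    ≡⟨ weight-factor-+ (q * 3) (toℕ s) (m * 3) ⟩
  weight (factor (q * 3) (m * 3)) + weight (factor (toℕ s) (m * 3 + q * 3))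
    ≡⟨ cong₂ _+_ (weight-aligned q m) (cong (weight ∘ factor (toℕ s)) (sym (*-distribʳ-+ 3 m q))) ⟩
  q * 3 + weight (factor (toℕ s) ((m + q) * 3)) ∎

weight-balance : ∀ n m q (r s : Fin 3) → toℕ r + n ≡ toℕ s + q * 3 →
  weight (factor n (toℕ r + m * 3)) + toℕ (excess (t3 m) r) ≡ n + toℕ (excess (t3 (m + q)) s)
weight-balance n m q r s eq = +-cancelˡ-≡ R _ _ (begin
  R + (weight (factor n (R + m * 3)) + X) ≡⟨ cong (λ i → R + (weight (factor n i) + X)) (+-comm R (m * 3)) ⟩
  R + (W + X)                             ≡⟨ x∙yz≈y∙xz R W X ⟩
  W + (R + X)                             ≡⟨ cong (W +_) (weight-block-prefix m r) ⟨
  W + (A + 1)                             ≡⟨ x∙yz≈yx∙z W A 1 ⟩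
  A + W + 1                               ≡⟨ cong (_+ 1) (weight-between-blocks n m q r s eq) ⟩
  q * 3 + B + 1                           ≡⟨ +-assoc (q * 3) B 1 ⟩
  q * 3 + (B + 1)                         ≡⟨ cong (q * 3 +_) (weight-block-prefix (m + q) s) ⟩
  q * 3 + (S + Y)                         ≡⟨ x∙yz≈yx∙z (q * 3) S Y ⟩
  S + q * 3 + Y                           ≡⟨ cong (_+ Y) eq ⟨
  R + n + Y                               ≡⟨ +-assoc R n Y ⟩
  R + (n + Y)                             ∎)
  where
  R = toℕ r
  S = toℕ s
  X = toℕ (excess (t3 m) r)
  Y = toℕ (excess (t3 (m + q)) s)
  A = weight (factor R (m * 3))
  W = weight (factor n (m * 3 + R))
  B = weight (factor S ((m + q) * 3))

cancel-offset : ∀ {w k e x y} → w + x ≡ 2 + k + y → e + x ≡ 2 + y → w ≡ k + e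
cancel-offset {w} {k} {e} {x} {y} w+x e+x = +-cancelʳ-≡ x w (k + e) (begin
  w + x       ≡⟨ w+x ⟩
  2 + k + y   ≡⟨ cong (_+ y) (+-comm 2 k) ⟩
  k + 2 + y   ≡⟨ +-assoc k 2 y ⟩
  k + (2 + y) ≡⟨ cong (k +_) e+x ⟨
  k + (e + x) ≡⟨ +-assoc k e x ⟨
  k + e + x   ∎)

balance⇒offset : ∀ {w k} (x y : Fin 3) → w + toℕ x ≡ 2 + k + toℕ y → ∃ λ e → e < 5 × w ≡ k + e
balance⇒offset x y w+x =
  2 + toℕ y ∸ toℕ x ,
  s≤s (≤-trans (m∸n≤m (2 + toℕ y) (toℕ x)) (+-monoʳ-≤ 2 (≤-pred (toℕ<n y)))) ,
  cancel-offset w+x (m∸n+n≡m (≤-trans (≤-pred (toℕ<n x)) (m≤m+n 2 (toℕ y))))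

offset-as-difference : ∀ e → e < 5 → ∃₂ λ (x y : Fin 3) → e + toℕ x ≡ 2 + toℕ y
offset-as-difference 0 _ = suc (suc zero) , zero , refl
offset-as-difference 1 _ = suc zero , zero , refl
offset-as-difference 2 _ = zero , zero , refl
offset-as-difference 3 _ = zero , suc zero , refl
offset-as-difference 4 _ = zero , suc (suc zero) , refl
offset-as-difference (suc (suc (suc (suc (suc _))))) (s≤s (s≤s (s≤s (s≤s (s≤s ())))))

nonzero-residues : ∀ n → 2 ≤ n → ∃₂ λ (r s : Fin 2) → ∃ λ q → toℕ (suc r) + n ≡ toℕ (suc s) + suc q * 3
nonzero-residues n 2≤n with n divMod 3
... | result p c refl = residues p c 2≤n
  where
  residues : ∀ p (c : Fin 3) → 2 ≤ toℕ c + p * 3 →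
             ∃₂ λ (r s : Fin 2) → ∃ λ q → toℕ (suc r) + (toℕ c + p * 3) ≡ toℕ (suc s) + suc q * 3
  residues (suc p) zero             _ = zero , zero , p , refl
  residues (suc p) (suc zero)       _ = zero , suc zero , p , refl
  residues p       (suc (suc zero)) _ = suc zero , zero , p , refl
  residues zero    (suc zero)       (s≤s ())

PairsAt : ℕ → Set
PairsAt q = ∀ a b → ∃ λ m → t3 m ≡ a × t3 (m + q) ≡ b

pairsAt-1 : PairsAt 1
pairsAt-1 zero             zero             = 44 , refl , refl
pairsAt-1 zero             (suc zero)       = 0  , refl , refl
pairsAt-1 zero             (suc (suc zero)) = 5  , refl , refl
pairsAt-1 (suc zero)       zero             = 14 , refl , refl
pairsAt-1 (suc zero)       (suc zero)       = 8  , refl , refl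
pairsAt-1 (suc zero)       (suc (suc zero)) = 1  , refl , refl
pairsAt-1 (suc (suc zero)) zero             = 4  , refl , refl
pairsAt-1 (suc (suc zero)) (suc zero)       = 2  , refl , refl
pairsAt-1 (suc (suc zero)) (suc (suc zero)) = 17 , refl , refl

pairsAt-2 : PairsAt 2
pairsAt-2 zero             zero             = 5  , refl , refl
pairsAt-2 zero             (suc zero)       = 7  , refl , refl
pairsAt-2 zero             (suc (suc zero)) = 0  , refl , refl
pairsAt-2 (suc zero)       zero             = 3  , refl , refl
pairsAt-2 (suc zero)       (suc zero)       = 1  , refl , refl
pairsAt-2 (suc zero)       (suc (suc zero)) = 8  , refl , refl
pairsAt-2 (suc (suc zero)) zero             = 17 , refl , refl
pairsAt-2 (suc (suc zero)) (suc zero)       = 6  , refl , refl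
pairsAt-2 (suc (suc zero)) (suc (suc zero)) = 2  , refl , refl

pairsAt-digit : ∀ q (c : Fin 3) → PairsAt q → PairsAt (toℕ c + q * 3)
pairsAt-digit q c pairs a b
  with b′ , σb′≡b ← σ-column-surjective c b
  with m , ta , tb ← pairs a b′ =
  m * 3 , trans (t3-triple m) ta , (begin
    t3 (m * 3 + (toℕ c + q * 3))      ≡⟨ cong t3 (index m q (toℕ c)) ⟩
    t3 ((m + q) * 3 + toℕ c)          ≡⟨ t3-σ (m + q) c ⟩
    lookupOr (σ (t3 (m + q))) (toℕ c) ≡⟨ cong (λ x → lookupOr (σ x) (toℕ c)) tb ⟩
    lookupOr (σ b′) (toℕ c)           ≡⟨ σb′≡b ⟩
    b                                 ∎)
  where
  index : ∀ m q c → m * 3 + (c + q * 3) ≡ (m + q) * 3 + c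
  index = solve-∀

pairsAt-suc : ∀ q → PairsAt (suc q)
pairsAt-suc = <-rec (PairsAt ∘ suc) step
  where
  step : ∀ q → (∀ {p} → p < q → PairsAt (suc p)) → PairsAt (suc q)
  step q rec with suc q divMod 3
  ... | result zero    (suc zero)       eq = subst PairsAt (sym eq) pairsAt-1
  ... | result zero    (suc (suc zero)) eq = subst PairsAt (sym eq) pairsAt-2
  ... | result (suc p) c                eq =
    subst PairsAt (sym eq) (pairsAt-digit (suc p) c (rec p<q))
    where
    p<q : p < q
    p<q = ≤-pred (≤-trans (m<m*n (suc p) 3 (s≤s (s≤s z≤n)))
                          (≤-trans (m≤n+m (suc p * 3) (toℕ c)) (≤-reflexive (sym eq))))

weight-bounded : ∀ k i → ∃ λ e → e < 5 × weight (factor (2 + k) i) ≡ k + e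
weight-bounded k i with i divMod 3
... | result m r refl with (toℕ r + (2 + k)) divMod 3
... | result q s eq = balance⇒offset (excess (t3 m) r) (excess (t3 (m + q)) s)
                        (weight-balance (2 + k) m q r s eq)

weight-attained : ∀ k e → e < 5 → ∃ λ i → weight (factor (2 + k) i) ≡ k + e
weight-attained k e e<5
  with r , s , q , eq ← nonzero-residues (2 + k) (s≤s (s≤s z≤n))
     | x , y , e+x ← offset-as-difference e e<5
  with a , refl ← excess-surjective r x
     | b , refl ← excess-surjective s y
  with m , refl , refl ← pairsAt-suc q a b =
  toℕ (suc r) + m * 3 , cancel-offset (weight-balance (2 + k) m (suc q) (suc r) (suc s) eq) e+x

theorem4p4 : AddComplexityIs 0 1 × AddComplexityIs 1 3 × (∀ n → 2 ≤ n → AddComplexityIs n 5)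
theorem4p4 = empty-factor , letters , long-factors
  where
  empty-factor : AddComplexityIs 0 1
  empty-factor = complexity-of-interval 0 0 1 (λ _ → 0 , z<s , refl) λ where
    zero    _         → 0 , refl
    (suc _) (s≤s ())
  letters : AddComplexityIs 1 3
  letters = complexity-of-interval 1 0 3 (λ i → toℕ (t3 i) , toℕ<n (t3 i) , letter-weight i) λ where
    0 _ → 0 , refl
    1 _ → 1 , refl
    2 _ → 2 , refl
    (suc (suc (suc _))) (s≤s (s≤s (s≤s ())))
  long-factors : ∀ n → 2 ≤ n → AddComplexityIs n 5
  long-factors (suc zero)    (s≤s ())
  long-factors (suc (suc k)) _ = complexity-of-interval (2 + k) k 5 (weight-bounded k) (weight-attained k)
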